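{- For every integer $n\ge 4$: $\mathrm{wdim}_k(K_n\times K_n)=n^2$ for $k\in\{2n+1,2n+2\}$; $\mathrm{wdim}_{2n}(K_n\times K_n)=n^2-1$; $\mathrm{wdim}_{2n-1}(K_n\times K_n)=n^2-n$ if $n\ge 5$; and $\mathrm{wdim}_7(K_4\times K_4)=13$.
   Context: $K_n\times K_n$ is the direct product of two complete graphs: vertex set $[n]\times[n]$ with $[n]=\{1,\dots,n\}$, where $(i,j)$ and $(i',j')$ are adjacent iff $i\ne i'$ and $j\ne j'$. With $d$ the shortest-path distance, for $S\subseteq V$ and vertices $x,y,z$: $\Delta_z(x,y)=|d(x,z)-d(y,z)|$ and $\Delta_S(x,y)=\sum_{z\in S}\Delta_z(x,y)$. A set $S$ of vertices is a weak $k$-resolving set if $\Delta_S(x,y)\ge k$ for all distinct vertices $x,y$. The weak $k$-metric dimension $\mathrm{wdim}_k(G)$ is the minimum cardinality of a weak $k$-resolving set of $G$. -}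

module Defs where

open import Data.Bool using (Bool; true; false; if_then_else_; _∨_; _∧_; not)
open import Data.Nat using (ℕ; zero; suc; _≤_; ∣_-_∣)
open import Data.Fin using (Fin)
open import Data.Fin.Properties using () renaming (_≟_ to _≟F_)
open import Data.Product using (_×_; _,_; ∃-syntax; proj₁; proj₂)
open import Data.List using (List; []; _∷_; length; map; cartesianProduct; allFin)
open import Data.Bool.ListAction using (any)
open import Data.Nat.ListAction using (sum)
open import Data.List.Membership.Propositional using (_∈_)
open import Data.List.Relation.Unary.Unique.Propositional using (Unique)
open import Relation.Binary.PropositionalEquality using (_≡_)
open import Relation.Binary.Definitions using (DecidableEquality)
open import Relation.Nullary using (¬_)
open import Relation.Nullary.Decidable using (⌊_⌋)

record FinGraph : Set₁ where
  field
    V        : Set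
    _≟V_     : DecidableEquality V
    vertices : List V
    adj      : V → V → Bool

module _ (G : FinGraph) where
  open FinGraph G

  reach : ℕ → V → V → Bool
  reach zero    x y = ⌊ x ≟V y ⌋
  reach (suc m) x y = reach m x y ∨ any (λ z → adj x z ∧ reach m z y) vertices

  leastFrom : (ℕ → Bool) → ℕ → ℕ → ℕ
  leastFrom p zero       k = k
  leastFrom p (suc fuel) k = if p k then k else leastFrom p fuel (suc k)

  -- shortest-path distance d(x,y): least m such that y is reachable from
  -- x by a walk of length m (searched up to |V|, which suffices whenever
  -- y is reachable from x at all; all graphs considered here are connected)
  dist : V → V → ℕ
  dist x y = leastFrom (λ m → reach m x y) (length vertices) 0

  Δ : V → V → V → ℕ
  Δ z x y = ∣ dist x z - dist y z ∣

  ΔS : List V → V → V → ℕ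
  ΔS S x y = sum (map (λ z → Δ z x y) S)

  IsWeakResolving : ℕ → List V → Set
  IsWeakResolving k S = Unique S × ((x y : V) → ¬ x ≡ y → k ≤ ΔS S x y)

  IsWdim : ℕ → ℕ → Set
  IsWdim k m =
    (∃[ S ] (IsWeakResolving k S × length S ≡ m)) ×
    ((S : List V) → IsWeakResolving k S → m ≤ length S)

KnxKn : ℕ → FinGraph
KnxKn n = record
  { V        = Fin n × Fin n
  ; _≟V_     = eq
  ; vertices = cartesianProduct (allFin n) (allFin n)
  ; adj      = λ x y → not ⌊ proj₁ x ≟F proj₁ y ⌋ ∧ not ⌊ proj₂ x ≟F proj₂ y ⌋
  }
  where
    open import Data.Product.Properties using (≡-dec)
    eq : DecidableEquality (Fin n × Fin n)
    eq = ≡-dec _≟F_ _≟F_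

{-# OPTIONS --safe #-}
module Submission where

-- In K_n × K_n (n ≥ 3) distinct vertices are at distance 2 when they share a row or a column and at
-- distance 1 otherwise.  Summing Δ_z(x,y) over all vertices z gives 2n+2 for a pair in a common line
-- and 4n-6 for any other pair, so a set S is weak k-resolving iff for every pair the vertices missing
-- from S lose at most total - k.  Deleting one vertex loses at most 2, and deleting the diagonal loses
-- at most 3 on collinear pairs and at most 4 on the others; this gives the upper bounds.  Conversely a
-- missing vertex u loses 2 on a collinear pair through u, two missing vertices lose at least 3 on a
-- suitable collinear pair, and two missing vertices in one line lose 4 on that line.  For n = 4 four
-- missing vertices would form a transversal {(i , σ i)}, and the pair (0 , σ 2), (1 , σ 3) would lose
-- 4 of its total 10.

open import Defs
open import Algebra.Properties.CommutativeSemigroup using (interchange)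
open import Data.Bool using (Bool; true; false; not; _∧_; _∨_; T)
open import Data.Bool.Properties using (T-∨; T-∧; ¬-not)
open import Data.Empty using (⊥; ⊥-elim)
open import Data.Fin using (Fin; zero; suc; #_; fromℕ<)
open import Data.Fin.Properties using (_≟_)
open import Data.List using (List; []; _∷_; length; map; _++_; cartesianProduct; filterᵇ; allFin)
open import Data.List.Membership.Propositional using (_∈_)
open import Data.List.Membership.Propositional.Properties using (∈-allFin; ∈-cartesianProduct⁺)
open import Data.List.Properties using (map-++; map-∘; length-tabulate)
open import Data.List.Relation.Unary.All as All using (All; []; _∷_)
open import Data.List.Relation.Unary.All.Properties using (All¬⇒¬Any)
open import Data.List.Relation.Unary.AllPairs using ([]; _∷_)
open import Data.List.Relation.Unary.Any as Any using (here; there)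
open import Data.List.Relation.Unary.Any.Properties using (any⁺; any⁻)
open import Data.List.Relation.Unary.Unique.Propositional using (Unique)
open import Data.List.Relation.Unary.Unique.Propositional.Properties using (allFin⁺; cartesianProduct⁺; filter⁺)
open import Data.Nat using (ℕ; zero; suc; _≤_; _<_; _+_; _*_; _∸_; z≤n; s≤s; s≤s⁻¹; z<s; ∣_-_∣)
open import Data.Nat.ListAction using (sum)
open import Data.Nat.ListAction.Properties using (sum-++)
open import Data.Nat.Properties hiding (_≟_)
open import Data.Nat.Tactic.RingSolver using (solve-∀)
open import Data.Product using (_×_; _,_; ∃-syntax; proj₁; proj₂; swap)
open import Data.Product.Properties using (,-injectiveˡ; ,-injectiveʳ)
open import Data.Sum using (inj₁; inj₂)
open import Function using (_∘_; id; Equivalence)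
open import Relation.Binary.Definitions using (DecidableEquality)
open import Relation.Binary.PropositionalEquality
open import Relation.Nullary using (¬_; yes; no; does)
open import Relation.Nullary.Decidable using (⌊_⌋; T?; dec-true; dec-false; toWitness; fromWitness)

infix 7 _when_

_when_ : ℕ → Bool → ℕ
x when true  = x
x when false = 0

when-≤ : ∀ x b → x when b ≤ x
when-≤ x true  = ≤-refl
when-≤ x false = z≤n

when-mono : ∀ {x y} b → x ≤ y → x when b ≤ y when b
when-mono true  x≤y = x≤y
when-mono false _   = z≤n

when-true : ∀ x {b} → b ≡ true → x when b ≡ x
when-true x refl = refl

when-split : ∀ x b → x when b + x when not b ≡ x
when-split x true  = +-identityʳ x
when-split x false = refl

when-∧ : ∀ x b c → x when (b ∧ c) ≡ (x when c) when b
when-∧ x true  c = refl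
when-∧ x false c = refl

module _ {A : Set} where

  ∑ : List A → (A → ℕ) → ℕ
  ∑ xs f = sum (map f xs)

  ∑-cong : ∀ {f g : A → ℕ} xs → (∀ z → f z ≡ g z) → ∑ xs f ≡ ∑ xs g
  ∑-cong []       f≗g = refl
  ∑-cong (x ∷ xs) f≗g = cong₂ _+_ (f≗g x) (∑-cong xs f≗g)

  ∑-mono : ∀ {f g : A → ℕ} xs → (∀ z → f z ≤ g z) → ∑ xs f ≤ ∑ xs g
  ∑-mono []       f≤g = z≤n
  ∑-mono (x ∷ xs) f≤g = +-mono-≤ (f≤g x) (∑-mono xs f≤g)

  ∑-distrib-+ : ∀ (f g : A → ℕ) xs → ∑ xs (λ z → f z + g z) ≡ ∑ xs f + ∑ xs g
  ∑-distrib-+ f g []       = refl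
  ∑-distrib-+ f g (x ∷ xs) = trans (cong (f x + g x +_) (∑-distrib-+ f g xs))
                                   (interchange +-commutativeSemigroup (f x) (g x) _ _)

  ∑-distrib-+₄ : ∀ (f g h k : A → ℕ) xs →
                 ∑ xs (λ z → f z + g z + h z + k z) ≡ ∑ xs f + ∑ xs g + ∑ xs h + ∑ xs k
  ∑-distrib-+₄ f g h k xs = trans (∑-distrib-+ (λ z → f z + g z + h z) k xs) (cong (_+ ∑ xs k)
    (trans (∑-distrib-+ (λ z → f z + g z) h xs) (cong (_+ ∑ xs h) (∑-distrib-+ f g xs))))

  ∑-const : ∀ c xs → ∑ xs (λ _ → c) ≡ length xs * c
  ∑-const c []       = refl
  ∑-const c (x ∷ xs) = cong (c +_) (∑-const c xs)

  ∑-zero : ∀ xs → ∑ xs (λ _ → 0) ≡ 0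
  ∑-zero xs = trans (∑-const 0 xs) (*-zeroʳ (length xs))

  ∑-one : ∀ xs → ∑ xs (λ _ → 1) ≡ length xs
  ∑-one xs = trans (∑-const 1 xs) (*-identityʳ (length xs))

  ∑≤length : ∀ {f : A → ℕ} xs → (∀ z → f z ≤ 1) → ∑ xs f ≤ length xs
  ∑≤length xs f≤1 = ≤-trans (∑-mono xs f≤1) (≤-reflexive (∑-one xs))

  length≤∑⇒All-positive : ∀ {f : A → ℕ} xs → (∀ z → f z ≤ 1) → length xs ≤ ∑ xs f →
                          All (λ z → 1 ≤ f z) xs
  length≤∑⇒All-positive         []       f≤1 _ = []
  length≤∑⇒All-positive {f = f} (x ∷ xs) f≤1 h with f x in fx | f≤1 x
  ... | 0           | _      = ⊥-elim (<⇒≱ h (∑≤length xs f≤1))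
  ... | 1           | _      = ≤-reflexive (sym fx) ∷ length≤∑⇒All-positive xs f≤1 (s≤s⁻¹ h)
  ... | suc (suc _) | s≤s ()

  ∑-++ : ∀ (f : A → ℕ) xs ys → ∑ (xs ++ ys) f ≡ ∑ xs f + ∑ ys f
  ∑-++ f xs ys = trans (cong sum (map-++ f xs ys)) (sum-++ (map f xs) (map f ys))

  ∑-filterᵇ : ∀ (f : A → ℕ) (p : A → Bool) xs → ∑ (filterᵇ p xs) f ≡ ∑ xs (λ z → f z when p z)
  ∑-filterᵇ f p []       = refl
  ∑-filterᵇ f p (x ∷ xs) with p x
  ... | true  = cong (f x +_) (∑-filterᵇ f p xs)
  ... | false = ∑-filterᵇ f p xs

  ∑-split : ∀ (f : A → ℕ) (p : A → Bool) xs →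
            ∑ xs (λ z → f z when p z) + ∑ xs (λ z → f z when not (p z)) ≡ ∑ xs f
  ∑-split f p xs = trans (sym (∑-distrib-+ (λ z → f z when p z) (λ z → f z when not (p z)) xs))
                         (∑-cong xs (λ z → when-split (f z) (p z)))

  ∑-when-false : ∀ (f : A → ℕ) {p : A → Bool} xs → All (λ z → p z ≡ false) xs →
                 ∑ xs (λ z → f z when p z) ≡ 0
  ∑-when-false f     []       []         = refl
  ∑-when-false f {p} (x ∷ xs) (_ ∷ rest) with p x
  ... | false = ∑-when-false f xs rest

  ∑-when-witness : ∀ {p : A → Bool} xs → 1 ≤ ∑ xs (λ z → 1 when p z) → ∃[ z ] p z ≡ true
  ∑-when-witness {p} (x ∷ xs) h with p x in px
  ... | true  = x , px
  ... | false = ∑-when-witness xs h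

  ∑-at-most-one : ∀ {p : A → Bool} xs → Unique xs →
                  (∀ {u w} → p u ≡ true → p w ≡ true → u ≡ w) → ∑ xs (λ z → 1 when p z) ≤ 1
  ∑-at-most-one     []       _                  _        = z≤n
  ∑-at-most-one {p} (x ∷ xs) (x∉xs ∷ xs-unique) p-unique with p x in px
  ... | false = ∑-at-most-one xs xs-unique p-unique
  ... | true  = ≤-reflexive (cong suc (∑-when-false (λ _ → 1) xs
                  (All.map (λ x≢z → ¬-not (x≢z ∘ p-unique px)) x∉xs)))

module _ {A B : Set} where

  ∑-cartesianProduct : ∀ (f : A × B → ℕ) xs ys →
                       ∑ (cartesianProduct xs ys) f ≡ ∑ xs (λ i → ∑ ys (λ j → f (i , j)))
  ∑-cartesianProduct f []       ys = refl
  ∑-cartesianProduct f (x ∷ xs) ys = trans (∑-++ f (map (x ,_) ys) _)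
    (cong₂ _+_ (cong sum (sym (map-∘ ys))) (∑-cartesianProduct f xs ys))

  ∑-comm : ∀ (f : A → B → ℕ) xs ys →
           ∑ xs (λ i → ∑ ys (λ j → f i j)) ≡ ∑ ys (λ j → ∑ xs (λ i → f i j))
  ∑-comm f []       ys = sym (∑-zero ys)
  ∑-comm f (x ∷ xs) ys = trans (cong (∑ ys (f x) +_) (∑-comm f xs ys)) (sym (∑-distrib-+ (f x) _ ys))

∑-point : ∀ {A : Set} (_≟_ : DecidableEquality A) (g : A → ℕ) {s} xs → Unique xs → s ∈ xs →
          ∑ xs (λ z → g z when does (s ≟ z)) ≡ g s
∑-point _≟_ g (x ∷ xs) (x∉xs ∷ _) (here refl) rewrite dec-true (x ≟ x) refl =
  trans (cong (g x +_) (∑-when-false g xs (All.map (dec-false (x ≟ _)) x∉xs))) (+-identityʳ (g x))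
∑-point _≟_ g {s} (x ∷ xs) (x∉xs ∷ xs-unique) (there s∈xs)
  rewrite dec-false (s ≟ x) (λ { refl → All¬⇒¬Any x∉xs s∈xs }) = ∑-point _≟_ g xs xs-unique s∈xs

module Enumeration {A : Set} (_≟_ : DecidableEquality A) (U : List A)
                   (U-unique : Unique U) (U-complete : ∀ z → z ∈ U) where

  open import Data.List.Membership.DecPropositional _≟_ using (_∈?_)

  ∑-member : ∀ (g : A → ℕ) xs → Unique xs → ∑ xs g ≡ ∑ U (λ z → g z when does (z ∈? xs))
  ∑-member g []       _                  = sym (∑-zero U)
  ∑-member g (s ∷ xs) (s∉xs ∷ xs-unique) = begin
    g s + ∑ xs g
      ≡⟨ cong₂ _+_ (sym (∑-point _≟_ g U U-unique (U-complete s))) (∑-member g xs xs-unique) ⟩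
    ∑ U (λ z → g z when does (s ≟ z)) + ∑ U (λ z → g z when does (z ∈? xs))
      ≡⟨ ∑-distrib-+ (λ z → g z when does (s ≟ z)) (λ z → g z when does (z ∈? xs)) U ⟨
    ∑ U (λ z → g z when does (s ≟ z) + g z when does (z ∈? xs))
      ≡⟨ ∑-cong U new-or-old ⟩
    ∑ U (λ z → g z when does (z ∈? s ∷ xs)) ∎
    where
    open ≡-Reasoning
    new-or-old : ∀ z → g z when does (s ≟ z) + g z when does (z ∈? xs)
                         ≡ g z when (does (z ≟ s) ∨ does (z ∈? xs))
    new-or-old z with z ≟ s
    ... | yes refl rewrite dec-true (z ≟ z) refl | dec-false (z ∈? xs) (All¬⇒¬Any s∉xs) = +-identityʳ (g z)
    ... | no  z≢s  rewrite dec-false (s ≟ z) (z≢s ∘ sym) = refl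

  outside : List A → A → Bool
  outside S z = not (does (z ∈? S))

  complement : (A → Bool) → List A
  complement t = filterᵇ (not ∘ t) U

  count : (A → Bool) → ℕ
  count t = ∑ U (λ z → 1 when t z)

  MissesExactly : (A → Bool) → List A → Set
  MissesExactly t S = ∀ f → ∑ S f + ∑ U (λ z → f z when t z) ≡ ∑ U f

  complement-missesExactly : ∀ t → MissesExactly t (complement t)
  complement-missesExactly t f = trans (cong (_+ ∑ U (λ z → f z when t z)) (∑-filterᵇ f (not ∘ t) U))
    (trans (+-comm (∑ U (λ z → f z when not (t z))) _) (∑-split f t U))

  outside-missesExactly : ∀ S → Unique S → MissesExactly (outside S) S
  outside-missesExactly S S-unique f =
    trans (cong (_+ ∑ U (λ z → f z when outside S z)) (∑-member f S S-unique)) (∑-split f (λ z → does (z ∈? S)) U)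

  length-+-count : ∀ {t} S → MissesExactly t S → length S + count t ≡ length U
  length-+-count {t} S misses = begin
    length S + count t       ≡⟨ cong (_+ count t) (∑-one S) ⟨
    ∑ S (λ _ → 1) + count t  ≡⟨ misses (λ _ → 1) ⟩
    ∑ U (λ _ → 1)            ≡⟨ ∑-one U ⟩
    length U                 ∎
    where open ≡-Reasoning

  ∑-≤-when : ∀ {t : A → Bool} M → Unique M → All (λ z → t z ≡ true) M → ∀ f →
             ∑ M f ≤ ∑ U (λ z → f z when t z)
  ∑-≤-when {t} M M-unique M-t f = ≤-trans (≤-reflexive (∑-member f M M-unique)) (∑-mono U pointwise)
    where
    pointwise : ∀ z → f z when does (z ∈? M) ≤ f z when t z
    pointwise z with z ∈? M
    ... | yes z∈M = ≤-reflexive (sym (when-true (f z) (All.lookup M-t z∈M)))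
    ... | no  _   = z≤n

module _ (G : FinGraph) where
  open FinGraph G

  leastFrom-≡ : ∀ (p : ℕ → Bool) {fuel} k d → d < fuel →
                (∀ j → j < d → ¬ T (p (k + j))) → T (p (k + d)) → leastFrom G p fuel k ≡ k + d
  leastFrom-≡ p {suc _} k zero _ _ hit with p k | subst (T ∘ p) (+-identityʳ k) hit
  ... | true | _ = sym (+-identityʳ k)
  leastFrom-≡ p {suc _} k (suc d) (s≤s d<fuel) miss hit
    with p k | subst (λ i → ¬ T (p i)) (+-identityʳ k) (miss 0 z<s)
  ... | true  | k-misses = ⊥-elim (k-misses _)
  ... | false | _        = trans (leastFrom-≡ p (suc k) d d<fuel miss′ hit′) (sym (+-suc k d))
    where
    miss′ : ∀ j → j < d → ¬ T (p (suc k + j))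
    miss′ j j<d = subst (λ i → ¬ T (p i)) (+-suc k j) (miss (suc j) (s≤s j<d))
    hit′ : T (p (suc k + d))
    hit′ = subst (T ∘ p) (+-suc k d) hit

  IsWeakResolving-mono : ∀ {k k′ S} → k ≤ k′ → IsWeakResolving G k′ S → IsWeakResolving G k S
  IsWeakResolving-mono k≤k′ (S-unique , resolves) =
    S-unique , λ x y x≢y → ≤-trans k≤k′ (resolves x y x≢y)

  module _ (complete : ∀ v → v ∈ vertices) where

    reach-step : ∀ {m x y} z → T (adj x z) → T (reach G m z y) → T (reach G (suc m) x y)
    reach-step z xz zy = Equivalence.from T-∨ (inj₂ (any⁺ _
      (Any.map (λ { refl → Equivalence.from T-∧ (xz , zy) }) (complete z))))

    reach-zero : ∀ {x y} → T (reach G 0 x y) → x ≡ y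
    reach-zero {x} {y} = toWitness {a? = x ≟V y}

    reach-refl : ∀ {x} → T (reach G 0 x x)
    reach-refl {x} = fromWitness {a? = x ≟V x} refl

    unreachable-in-one : ∀ {x y} → x ≢ y → ¬ T (adj x y) → ¬ T (reach G 1 x y)
    unreachable-in-one {x} {y} x≢y ¬xy r with Equivalence.to T-∨ r
    ... | inj₁ x≡y = x≢y (reach-zero x≡y)
    ... | inj₂ via with Any.satisfied (any⁻ _ vertices via)
    ... | z , xz-zy = let xz , z≡y = Equivalence.to T-∧ xz-zy in ¬xy (subst (T ∘ adj x) (reach-zero z≡y) xz)

    module _ (enough-vertices : 2 < length vertices) where

      dist-≡ : ∀ {x y} d → d ≤ 2 → (∀ j → j < d → ¬ T (reach G j x y)) → T (reach G d x y) →
               dist G x y ≡ d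
      dist-≡ d d≤2 = leastFrom-≡ _ 0 d (≤-<-trans d≤2 enough-vertices)

      dist-self : ∀ x → dist G x x ≡ 0
      dist-self x = dist-≡ 0 z≤n (λ _ ()) reach-refl

      dist-adjacent : ∀ {x y} → x ≢ y → T (adj x y) → dist G x y ≡ 1
      dist-adjacent {x} {y} x≢y xy = dist-≡ 1 (s≤s z≤n) unreachable (reach-step {m = 0} y xy reach-refl)
        where
        unreachable : ∀ j → j < 1 → ¬ T (reach G j x y)
        unreachable zero z<s = x≢y ∘ reach-zero

      dist-common-neighbour : ∀ {x y} w → x ≢ y → ¬ T (adj x y) → T (adj x w) → T (adj w y) →
                              dist G x y ≡ 2
      dist-common-neighbour {x} {y} w x≢y ¬xy xw wy =
        dist-≡ 2 ≤-refl unreachable (reach-step {m = 1} w xw (reach-step {m = 0} y wy reach-refl))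
        where
        unreachable : ∀ j → j < 2 → ¬ T (reach G j x y)
        unreachable zero          _ = x≢y ∘ reach-zero
        unreachable (suc zero)    _ = unreachable-in-one x≢y ¬xy
        unreachable (suc (suc _)) (s≤s (s≤s ()))

  module _ (unique : Unique vertices) (complete : ∀ v → v ∈ vertices) where
    open Enumeration _≟V_ vertices unique complete

    IsWdim-intro : ∀ {k c} t → IsWeakResolving G k (complement t) → count t ≡ c →
                   (∀ S → IsWeakResolving G k S → count (outside S) ≤ c) → IsWdim G k (length vertices ∸ c)
    IsWdim-intro {k} {c} t resolving count≡c bound = (complement t , resolving , size) , minimal
      where
      size : length (complement t) ≡ length vertices ∸ c
      size = begin
        length (complement t)
          ≡⟨ m+n∸n≡m (length (complement t)) c ⟨
        length (complement t) + c ∸ c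
          ≡⟨ cong (λ m → length (complement t) + m ∸ c) count≡c ⟨
        length (complement t) + count t ∸ c
          ≡⟨ cong (_∸ c) (length-+-count (complement t) (complement-missesExactly t)) ⟩
        length vertices ∸ c ∎
        where open ≡-Reasoning
      minimal : ∀ S → IsWeakResolving G k S → length vertices ∸ c ≤ length S
      minimal S S-resolving@(S-unique , _) = m≤n+o⇒m∸n≤o (length vertices) c (begin
        length vertices              ≡⟨ length-+-count S (outside-missesExactly S S-unique) ⟨
        length S + count (outside S) ≤⟨ +-monoʳ-≤ (length S) (bound S S-resolving) ⟩
        length S + c                 ≡⟨ +-comm (length S) c ⟩
        c + length S                 ∎)
        where open ≤-Reasoning

-- distance p q is the distance from (a , b) to (i , j) in K_n × K_n, n ≥ 3, for p = [a = i], q = [b = j].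
distance : Bool → Bool → ℕ
distance true  true  = 0
distance true  false = 2
distance false true  = 2
distance false false = 1

distance-comm : ∀ p q → distance p q ≡ distance q p
distance-comm true  true  = refl
distance-comm true  false = refl
distance-comm false true  = refl
distance-comm false false = refl

distance≤2 : ∀ p q → distance p q ≤ 2
distance≤2 true  true  = z≤n
distance≤2 true  false = ≤-refl
distance≤2 false true  = ≤-refl
distance≤2 false false = s≤s z≤n

-- Δ_(i,j) of the pair (a , b), (a , b′) with b ≢ b′, for p = [a = i], q = [b = j], q′ = [b′ = j].
row-table : ∀ p q q′ → q ∧ q′ ≡ false →
  ∣ distance p q - distance p q′ ∣ ≡ 1 when q + 1 when q′ + 1 when (p ∧ q) + 1 when (p ∧ q′)
row-table true  true  false _ = refl
row-table true  false true  _ = refl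
row-table true  false false _ = refl
row-table false true  false _ = refl
row-table false false true  _ = refl
row-table false false false _ = refl
row-table _     true  true  ()

-- On the diagonal i = j; the bound is ∑ (a ∷ b ∷ b′ ∷ []) (λ c → 1 when does (c ≟ i)) unfolded.
row-table-≤ : ∀ p q q′ → q ∧ q′ ≡ false →
  ∣ distance p q - distance p q′ ∣ ≤ 1 when p + (1 when q + (1 when q′ + 0))
row-table-≤ true  true  false _ = ≤ᵇ⇒≤ _ _ _
row-table-≤ true  false true  _ = ≤ᵇ⇒≤ _ _ _
row-table-≤ true  false false _ = ≤ᵇ⇒≤ _ _ _
row-table-≤ false true  false _ = ≤ᵇ⇒≤ _ _ _
row-table-≤ false false true  _ = ≤ᵇ⇒≤ _ _ _
row-table-≤ false false false _ = ≤ᵇ⇒≤ _ _ _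
row-table-≤ _     true  true  ()

-- Δ_(i,j) of the pair (a , b), (a′ , b′) with a ≢ a′ and b ≢ b′, for p = [a = i], q = [b = j],
-- r = [a′ = i], s = [b′ = j].
apart-table : ∀ p q r s → p ∧ r ≡ false → q ∧ s ≡ false →
  ∣ distance p q - distance r s ∣ + (2 when (p ∧ s) + 2 when (r ∧ q) + 1 when (p ∧ q) + 1 when (r ∧ s))
    ≡ 1 when p + 1 when q + 1 when r + 1 when s
apart-table true  true  false false _ _ = refl
apart-table true  false false true  _ _ = refl
apart-table true  false false false _ _ = refl
apart-table false true  true  false _ _ = refl
apart-table false false true  true  _ _ = refl
apart-table false false true  false _ _ = refl
apart-table false true  false false _ _ = refl
apart-table false false false true  _ _ = refl
apart-table false false false false _ _ = refl
apart-table true  _     true  _     () _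
apart-table _     true  _     true  _  ()

apart-table-≤1 : ∀ p q r s → p ∧ r ≡ false → q ∧ s ≡ false → ∣ distance p q - distance r s ∣ ≤ 1
apart-table-≤1 true  true  false false _ _ = ≤ᵇ⇒≤ _ _ _
apart-table-≤1 true  false false true  _ _ = ≤ᵇ⇒≤ _ _ _
apart-table-≤1 true  false false false _ _ = ≤ᵇ⇒≤ _ _ _
apart-table-≤1 false true  true  false _ _ = ≤ᵇ⇒≤ _ _ _
apart-table-≤1 false false true  true  _ _ = ≤ᵇ⇒≤ _ _ _
apart-table-≤1 false false true  false _ _ = ≤ᵇ⇒≤ _ _ _
apart-table-≤1 false true  false false _ _ = ≤ᵇ⇒≤ _ _ _
apart-table-≤1 false false false true  _ _ = ≤ᵇ⇒≤ _ _ _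
apart-table-≤1 false false false false _ _ = ≤ᵇ⇒≤ _ _ _
apart-table-≤1 true  _     true  _     () _
apart-table-≤1 _     true  _     true  _  ()

+-reassoc₄ : ∀ p q r s → p + q + r + s ≡ p + (q + (r + (s + 0)))
+-reassoc₄ = solve-∀

∸1+suc : ∀ {m} → 1 ≤ m → ∀ c → m ∸ 1 + suc c ≡ m + c
∸1+suc {suc m} _ c = +-suc m c

2n+2+6≤4n : ∀ {n} → 4 ≤ n → 2 * n + 2 + 6 ≤ 4 * n
2n+2+6≤4n {n} 4≤n = begin
  2 * n + 2 + 6  ≡⟨ +-assoc (2 * n) 2 6 ⟩
  2 * n + 8      ≤⟨ +-monoʳ-≤ (2 * n) (*-monoʳ-≤ 2 4≤n) ⟩
  2 * n + 2 * n  ≡⟨ *-distribʳ-+ n 2 2 ⟨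
  4 * n          ∎
  where open ≤-Reasoning

avoid : ∀ {n} → 3 ≤ n → (a a′ : Fin n) → ∃[ i ] (a ≢ i × a′ ≢ i)
avoid (s≤s (s≤s (s≤s _))) zero          zero          = suc zero       , (λ ()) , (λ ())
avoid (s≤s (s≤s (s≤s _))) zero          (suc zero)    = suc (suc zero) , (λ ()) , (λ ())
avoid (s≤s (s≤s (s≤s _))) zero          (suc (suc _)) = suc zero       , (λ ()) , (λ ())
avoid (s≤s (s≤s (s≤s _))) (suc zero)    zero          = suc (suc zero) , (λ ()) , (λ ())
avoid (s≤s (s≤s (s≤s _))) (suc (suc _)) zero          = suc zero       , (λ ()) , (λ ())
avoid (s≤s (s≤s (s≤s _))) (suc _)       (suc _)       = zero           , (λ ()) , (λ ())

≟-exclusive : ∀ {n} {b b′ : Fin n} → b ≢ b′ → ∀ j → does (b ≟ j) ∧ does (b′ ≟ j) ≡ false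
≟-exclusive {b = b} {b′} b≢b′ j with b ≟ j | b′ ≟ j
... | yes refl | yes refl = ⊥-elim (b≢b′ refl)
... | yes _    | no _     = refl
... | no _     | _        = refl

module Geometry (n : ℕ) where

  G : FinGraph
  G = KnxKn n

  V : Set
  V = Fin n × Fin n

  open FinGraph G public using (_≟V_; vertices)

  vertices-unique : Unique vertices
  vertices-unique = cartesianProduct⁺ (allFin⁺ n) (allFin⁺ n)

  vertices-complete : ∀ z → z ∈ vertices
  vertices-complete (i , j) = ∈-cartesianProduct⁺ (∈-allFin i) (∈-allFin j)

  open Enumeration _≟V_ vertices vertices-unique vertices-complete public

  on-row : Fin n → V → ℕ
  on-row a z = 1 when does (a ≟ proj₁ z)

  on-col : Fin n → V → ℕ
  on-col b z = 1 when does (b ≟ proj₂ z)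

  diagonal : (Fin n → Bool) → V → Bool
  diagonal P (i , j) = does (i ≟ j) ∧ P i

  length-allFin : length (allFin n) ≡ n
  length-allFin = length-tabulate id

  ∑V-rows : ∀ f → ∑ vertices f ≡ ∑ (allFin n) (λ i → ∑ (allFin n) (λ j → f (i , j)))
  ∑V-rows f = ∑-cartesianProduct f (allFin n) (allFin n)

  ∑V-transpose : ∀ f → ∑ vertices (f ∘ swap) ≡ ∑ vertices f
  ∑V-transpose f = begin
    ∑ vertices (f ∘ swap)                                ≡⟨ ∑V-rows (f ∘ swap) ⟩
    ∑ (allFin n) (λ i → ∑ (allFin n) (λ j → f (j , i)))  ≡⟨ ∑-comm (λ i j → f (j , i)) (allFin n) (allFin n) ⟩
    ∑ (allFin n) (λ j → ∑ (allFin n) (λ i → f (j , i)))  ≡⟨ ∑V-rows f ⟨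
    ∑ vertices f                                         ∎
    where open ≡-Reasoning

  length-vertices : length vertices ≡ n * n
  length-vertices = begin
    length vertices                              ≡⟨ ∑-one vertices ⟨
    ∑ vertices (λ _ → 1)                         ≡⟨ ∑V-rows (λ _ → 1) ⟩
    ∑ (allFin n) (λ _ → ∑ (allFin n) (λ _ → 1))  ≡⟨ ∑-const _ (allFin n) ⟩
    length (allFin n) * ∑ (allFin n) (λ _ → 1)   ≡⟨ cong₂ _*_ length-allFin (trans (∑-one (allFin n)) length-allFin) ⟩
    n * n                                        ∎
    where open ≡-Reasoning

  ∑Fin-point : ∀ (g : Fin n → ℕ) a → ∑ (allFin n) (λ i → g i when does (a ≟ i)) ≡ g a
  ∑Fin-point g a = ∑-point _≟_ g (allFin n) (allFin⁺ n) (∈-allFin a)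

  ∑V-point : ∀ (g : V → ℕ) x → ∑ vertices (λ z → g z when does (x ≟V z)) ≡ g x
  ∑V-point g x = ∑-point _≟V_ g vertices vertices-unique (vertices-complete x)

  ∑V-col : ∀ b → ∑ vertices (on-col b) ≡ n
  ∑V-col b = begin
    ∑ vertices (on-col b)
      ≡⟨ ∑V-rows (on-col b) ⟩
    ∑ (allFin n) (λ _ → ∑ (allFin n) (λ j → 1 when does (b ≟ j)))
      ≡⟨ ∑-cong (allFin n) (λ _ → ∑Fin-point _ b) ⟩
    ∑ (allFin n) (λ _ → 1)
      ≡⟨ trans (∑-one (allFin n)) length-allFin ⟩
    n ∎
    where open ≡-Reasoning

  ∑V-row : ∀ a → ∑ vertices (on-row a) ≡ n
  ∑V-row a = trans (∑V-transpose (on-col a)) (∑V-col a)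

  ∑V-diagonal : ∀ (f : V → ℕ) P →
                ∑ vertices (λ z → f z when diagonal P z) ≡ ∑ (allFin n) (λ i → f (i , i) when P i)
  ∑V-diagonal f P = trans (∑V-rows _) (∑-cong (allFin n) λ i → trans
    (∑-cong (allFin n) (λ j → when-∧ (f (i , j)) (does (i ≟ j)) (P i)))
    (∑Fin-point (λ j → f (i , j) when P i) i))

  ∑Fin-multiplicity : ∀ cs → ∑ (allFin n) (λ i → ∑ cs (λ c → 1 when does (c ≟ i))) ≡ length cs
  ∑Fin-multiplicity cs = begin
    ∑ (allFin n) (λ i → ∑ cs (λ c → 1 when does (c ≟ i)))  ≡⟨ ∑-comm _ (allFin n) cs ⟩
    ∑ cs (λ c → ∑ (allFin n) (λ i → 1 when does (c ≟ i)))  ≡⟨ ∑-cong cs (∑Fin-point _) ⟩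
    ∑ cs (λ _ → 1)                                          ≡⟨ ∑-one cs ⟩
    length cs                                               ∎
    where open ≡-Reasoning

  ≟V-∧ : ∀ a b i j → does ((a , b) ≟V (i , j)) ≡ does (a ≟ i) ∧ does (b ≟ j)
  ≟V-∧ a b i j with (a , b) ≟V (i , j)
  ... | yes refl = sym (cong₂ _∧_ (dec-true (a ≟ a) refl) (dec-true (b ≟ b) refl))
  ... | no ab≢ij with a ≟ i | b ≟ j
  ...   | yes refl | yes refl = ⊥-elim (ab≢ij refl)
  ...   | yes _    | no _     = refl
  ...   | no _     | _        = refl

  d : V → V → ℕ
  d (a , b) (i , j) = distance (does (a ≟ i)) (does (b ≟ j))

  δ : V → V → V → ℕ
  δ z x y = ∣ d x z - d y z ∣

  total : V → V → ℕ
  total x y = ∑ vertices (λ z → δ z x y)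

  loss : (V → Bool) → V → V → ℕ
  loss t x y = ∑ vertices (λ z → δ z x y when t z)

  data Position : V → V → Set where
    equal    : ∀ {x} → Position x x
    same-row : ∀ {a b b′} → b ≢ b′ → Position (a , b) (a , b′)
    same-col : ∀ {a a′ b} → a ≢ a′ → Position (a , b) (a′ , b)
    apart    : ∀ {a a′ b b′} → a ≢ a′ → b ≢ b′ → Position (a , b) (a′ , b′)

  position : ∀ x y → Position x y
  position (a , b) (a′ , b′) with a ≟ a′ | b ≟ b′
  ... | yes refl | yes refl = equal
  ... | yes refl | no b≢b′  = same-row b≢b′
  ... | no a≢a′  | yes refl = same-col a≢a′
  ... | no a≢a′  | no b≢b′  = apart a≢a′ b≢b′

  d-self : ∀ x → d x x ≡ 0
  d-self (a , b) = cong₂ distance (dec-true (a ≟ a) refl) (dec-true (b ≟ b) refl)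

  d-same-row : ∀ {a b b′} → b ≢ b′ → d (a , b) (a , b′) ≡ 2
  d-same-row {a} {b} {b′} b≢b′ = cong₂ distance (dec-true (a ≟ a) refl) (dec-false (b ≟ b′) b≢b′)

  d-same-col : ∀ {a a′ b} → a ≢ a′ → d (a , b) (a′ , b) ≡ 2
  d-same-col {a} {a′} {b} a≢a′ = cong₂ distance (dec-false (a ≟ a′) a≢a′) (dec-true (b ≟ b) refl)

  d-apart : ∀ {a a′ b b′} → a ≢ a′ → b ≢ b′ → d (a , b) (a′ , b′) ≡ 1
  d-apart {a} {a′} {b} {b′} a≢a′ b≢b′ =
    cong₂ distance (dec-false (a ≟ a′) a≢a′) (dec-false (b ≟ b′) b≢b′)

  d-transpose : ∀ x y → d (swap x) (swap y) ≡ d x y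
  d-transpose (a , b) (i , j) = distance-comm (does (b ≟ j)) (does (a ≟ i))

  δ-transpose : ∀ z x y → δ (swap z) (swap x) (swap y) ≡ δ z x y
  δ-transpose z x y = cong₂ ∣_-_∣ (d-transpose x z) (d-transpose y z)

  δ-left : ∀ x y → δ x x y ≡ d y x
  δ-left x y = cong (∣_- d y x ∣) (d-self x)

  δ-right : ∀ x y → δ y x y ≡ d x y
  δ-right x y = trans (cong (∣ d x y -_∣) (d-self y)) (∣-∣-identityʳ (d x y))

  δ≤2 : ∀ z x y → δ z x y ≤ 2
  δ≤2 z x y = ≤-trans (∣m-n∣≤m⊔n (d x z) (d y z)) (⊔-lub (d≤2 x z) (d≤2 y z))
    where
    d≤2 : ∀ x z → d x z ≤ 2
    d≤2 (a , b) (i , j) = distance≤2 (does (a ≟ i)) (does (b ≟ j))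

  δ-apart≤1 : ∀ {a a′ b b′} → a ≢ a′ → b ≢ b′ → ∀ z → δ z (a , b) (a′ , b′) ≤ 1
  δ-apart≤1 {a} {a′} {b} {b′} a≢a′ b≢b′ (i , j) = apart-table-≤1 (does (a ≟ i)) (does (b ≟ j))
    (does (a′ ≟ i)) (does (b′ ≟ j)) (≟-exclusive a≢a′ i) (≟-exclusive b≢b′ j)

  total-same-row : ∀ a {b b′} → b ≢ b′ → total (a , b) (a , b′) ≡ 2 * n + 2
  total-same-row a {b} {b′} b≢b′ = begin
    total (a , b) (a , b′)                                                      ≡⟨ ∑-cong vertices pointwise ⟩
    ∑ vertices (λ z → on-col b z + on-col b′ z + at (a , b) z + at (a , b′) z)  ≡⟨ lines-and-points ⟩
    n + n + 1 + 1                                                               ≡⟨ arithmetic n ⟩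
    2 * n + 2                                                                   ∎
    where
    open ≡-Reasoning
    at : V → V → ℕ
    at x z = 1 when does (x ≟V z)
    pointwise : ∀ z → δ z (a , b) (a , b′) ≡ on-col b z + on-col b′ z + at (a , b) z + at (a , b′) z
    pointwise (i , j) = trans
      (row-table (does (a ≟ i)) (does (b ≟ j)) (does (b′ ≟ j)) (≟-exclusive b≢b′ j))
      (cong₂ (λ p q → on-col b (i , j) + on-col b′ (i , j) + 1 when p + 1 when q)
             (sym (≟V-∧ a b i j)) (sym (≟V-∧ a b′ i j)))
    lines-and-points : ∑ vertices (λ z → on-col b z + on-col b′ z + at (a , b) z + at (a , b′) z)
                       ≡ n + n + 1 + 1
    lines-and-points = trans (∑-distrib-+₄ (on-col b) (on-col b′) (at (a , b)) (at (a , b′)) vertices)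
      (cong₂ _+_ (cong₂ _+_ (cong₂ _+_ (∑V-col b) (∑V-col b′)) (∑V-point _ (a , b)))
                 (∑V-point _ (a , b′)))
    arithmetic : ∀ m → m + m + 1 + 1 ≡ 2 * m + 2
    arithmetic = solve-∀

  total-same-col : ∀ b {a a′} → a ≢ a′ → total (a , b) (a′ , b) ≡ 2 * n + 2
  total-same-col b {a} {a′} a≢a′ = begin
    total (a , b) (a′ , b)
      ≡⟨ ∑-cong vertices (λ z → δ-transpose (swap z) (b , a) (b , a′)) ⟩
    ∑ vertices (λ z → δ (swap z) (b , a) (b , a′))
      ≡⟨ ∑V-transpose (λ z → δ z (b , a) (b , a′)) ⟩
    total (b , a) (b , a′)
      ≡⟨ total-same-row b a≢a′ ⟩
    2 * n + 2 ∎
    where open ≡-Reasoning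

  total-apart : ∀ {a a′ b b′} → a ≢ a′ → b ≢ b′ → total (a , b) (a′ , b′) + 6 ≡ 4 * n
  total-apart {a} {a′} {b} {b′} a≢a′ b≢b′ = begin
    total x y + 6                                                           ≡⟨ cong (total x y +_) corners ⟨
    total x y + ∑ vertices corner-terms                                     ≡⟨ ∑-distrib-+ (λ z → δ z x y) corner-terms vertices ⟨
    ∑ vertices (λ z → δ z x y + corner-terms z)                             ≡⟨ ∑-cong vertices pointwise ⟩
    ∑ vertices (λ z → on-row a z + on-col b z + on-row a′ z + on-col b′ z)  ≡⟨ lines ⟩
    n + n + n + n                                                           ≡⟨ arithmetic n ⟩
    4 * n                                                                   ∎
    where
    open ≡-Reasoning
    x y : V
    x = (a , b)
    y = (a′ , b′)
    at : ℕ → V → V → ℕ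
    at m w z = m when does (w ≟V z)
    corner-terms : V → ℕ
    corner-terms z = at 2 (a , b′) z + at 2 (a′ , b) z + at 1 x z + at 1 y z
    corners : ∑ vertices corner-terms ≡ 6
    corners = trans (∑-distrib-+₄ (at 2 (a , b′)) (at 2 (a′ , b)) (at 1 x) (at 1 y) vertices)
      (cong₂ _+_ (cong₂ _+_ (cong₂ _+_ (∑V-point _ (a , b′)) (∑V-point _ (a′ , b))) (∑V-point _ x))
                 (∑V-point _ y))
    pointwise : ∀ z → δ z x y + corner-terms z ≡ on-row a z + on-col b z + on-row a′ z + on-col b′ z
    pointwise (i , j) = trans
      (cong (δ (i , j) x y +_) (cong₂ _+_ (cong₂ _+_ (cong₂ _+_
        (cong (2 when_) (≟V-∧ a b′ i j)) (cong (2 when_) (≟V-∧ a′ b i j)))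
        (cong (1 when_) (≟V-∧ a b i j))) (cong (1 when_) (≟V-∧ a′ b′ i j))))
      (apart-table (does (a ≟ i)) (does (b ≟ j)) (does (a′ ≟ i)) (does (b′ ≟ j))
                   (≟-exclusive a≢a′ i) (≟-exclusive b≢b′ j))
    lines : ∑ vertices (λ z → on-row a z + on-col b z + on-row a′ z + on-col b′ z) ≡ n + n + n + n
    lines = trans (∑-distrib-+₄ (on-row a) (on-col b) (on-row a′) (on-col b′) vertices)
      (cong₂ _+_ (cong₂ _+_ (cong₂ _+_ (∑V-row a) (∑V-col b)) (∑V-row a′)) (∑V-col b′))
    arithmetic : ∀ m → m + m + m + m ≡ 4 * m
    arithmetic = solve-∀

  total-≥ : 4 ≤ n → ∀ {x y} → x ≢ y → 2 * n + 2 ≤ total x y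
  total-≥ 4≤n x≢y = by-position (position _ _) x≢y
    where
    by-position : ∀ {x y} → Position x y → x ≢ y → 2 * n + 2 ≤ total x y
    by-position equal                  x≢x = ⊥-elim (x≢x refl)
    by-position (same-row {a} b≢b′)    _   = ≤-reflexive (sym (total-same-row a b≢b′))
    by-position (same-col {b = b} a≢a′) _  = ≤-reflexive (sym (total-same-col b a≢a′))
    by-position (apart a≢a′ b≢b′)      _   =
      +-cancelʳ-≤ 6 _ _ (≤-trans (2n+2+6≤4n 4≤n) (≤-reflexive (sym (total-apart a≢a′ b≢b′))))

  diagonal-δ : V → V → ℕ
  diagonal-δ x y = ∑ (allFin n) (λ i → δ (i , i) x y)

  diagonal-δ-same-row : ∀ a {b b′} → b ≢ b′ → diagonal-δ (a , b) (a , b′) ≤ 3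
  diagonal-δ-same-row a {b} {b′} b≢b′ = ≤-trans
    (∑-mono (allFin n) λ i →
      row-table-≤ (does (a ≟ i)) (does (b ≟ i)) (does (b′ ≟ i)) (≟-exclusive b≢b′ i))
    (≤-reflexive (∑Fin-multiplicity (a ∷ b ∷ b′ ∷ [])))

  diagonal-δ-same-col : ∀ b {a a′} → a ≢ a′ → diagonal-δ (a , b) (a′ , b) ≤ 3
  diagonal-δ-same-col b {a} {a′} a≢a′ =
    subst (_≤ 3) (∑-cong (allFin n) (λ i → δ-transpose (i , i) (a , b) (a′ , b)))
                 (diagonal-δ-same-row b a≢a′)

  diagonal-δ-apart : ∀ {a a′ b b′} → a ≢ a′ → b ≢ b′ → diagonal-δ (a , b) (a′ , b′) ≤ 4
  diagonal-δ-apart {a} {a′} {b} {b′} a≢a′ b≢b′ =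
    ≤-trans (∑-mono (allFin n) pointwise) (≤-reflexive (∑Fin-multiplicity (a ∷ b ∷ a′ ∷ b′ ∷ [])))
    where
    pointwise : ∀ i → δ (i , i) (a , b) (a′ , b′) ≤
                      ∑ (a ∷ b ∷ a′ ∷ b′ ∷ []) (λ c → 1 when does (c ≟ i))
    pointwise i = let p = does (a ≟ i); q = does (b ≟ i); r = does (a′ ≟ i); s = does (b′ ≟ i) in
      ≤-trans (m≤m+n _ _) (≤-reflexive (trans
        (apart-table p q r s (≟-exclusive a≢a′ i) (≟-exclusive b≢b′ i))
        (+-reassoc₄ (1 when p) (1 when q) (1 when r) (1 when s))))

  adjacent-apart : ∀ {a a′ b b′ : Fin n} → a ≢ a′ → b ≢ b′ →
                   T (not ⌊ a ≟ a′ ⌋ ∧ not ⌊ b ≟ b′ ⌋)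
  adjacent-apart {a} {a′} {b} {b′} a≢a′ b≢b′ with a ≟ a′ | b ≟ b′
  ... | yes a≡a′ | _        = a≢a′ a≡a′
  ... | no _     | yes b≡b′ = b≢b′ b≡b′
  ... | no _     | no _     = _

  not-adjacent-same-row : ∀ {a b b′ : Fin n} → ¬ T (not ⌊ a ≟ a ⌋ ∧ not ⌊ b ≟ b′ ⌋)
  not-adjacent-same-row {a} with a ≟ a
  ... | yes _   = λ ()
  ... | no  a≢a = ⊥-elim (a≢a refl)

  not-adjacent-same-col : ∀ {a a′ b : Fin n} → ¬ T (not ⌊ a ≟ a′ ⌋ ∧ not ⌊ b ≟ b ⌋)
  not-adjacent-same-col {a} {a′} {b} with a ≟ a′ | b ≟ b
  ... | _     | no b≢b = ⊥-elim (b≢b refl)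
  ... | yes _ | yes _  = λ ()
  ... | no _  | yes _  = λ ()

  module _ (3≤n : 3 ≤ n) where

    enough-vertices : 2 < length vertices
    enough-vertices = subst (2 <_) (sym length-vertices) (*-mono-≤ 3≤n (≤-trans (s≤s z≤n) 3≤n))

    dist≡d : ∀ x y → dist G x y ≡ d x y
    dist≡d x y with position x y
    ... | equal = trans (dist-self G vertices-complete enough-vertices x) (sym (d-self x))
    ... | same-row {a} {b} {b′} b≢b′ with avoid 3≤n a a | avoid 3≤n b b′
    ...   | i , a≢i , _ | j , b≢j , b′≢j = trans
      (dist-common-neighbour G vertices-complete enough-vertices (i , j) (b≢b′ ∘ ,-injectiveʳ)
        (not-adjacent-same-row {a} {b} {b′})
        (adjacent-apart a≢i b≢j) (adjacent-apart (a≢i ∘ sym) (b′≢j ∘ sym)))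
      (sym (d-same-row {a} b≢b′))
    dist≡d x y | same-col {a} {a′} {b} a≢a′ with avoid 3≤n a a′ | avoid 3≤n b b
    ...   | i , a≢i , a′≢i | j , b≢j , _ = trans
      (dist-common-neighbour G vertices-complete enough-vertices (i , j) (a≢a′ ∘ ,-injectiveˡ)
        (not-adjacent-same-col {a} {a′} {b})
        (adjacent-apart a≢i b≢j) (adjacent-apart (a′≢i ∘ sym) (b≢j ∘ sym)))
      (sym (d-same-col {b = b} a≢a′))
    dist≡d x y | apart a≢a′ b≢b′ = trans
      (dist-adjacent G vertices-complete enough-vertices (a≢a′ ∘ ,-injectiveˡ)
        (adjacent-apart a≢a′ b≢b′))
      (sym (d-apart a≢a′ b≢b′))

    ΔS-+-loss : ∀ {t} S → MissesExactly t S → ∀ x y → ΔS G S x y + loss t x y ≡ total x y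
    ΔS-+-loss {t} S misses x y = trans
      (cong (_+ loss t x y) (∑-cong S (λ z → cong₂ ∣_-_∣ (dist≡d x z) (dist≡d y z))))
      (misses (λ z → δ z x y))

    complement-resolving : ∀ {k} t → (∀ x y → x ≢ y → k + loss t x y ≤ total x y) →
                           IsWeakResolving G k (complement t)
    complement-resolving {k} t bound = filter⁺ (T? ∘ (not ∘ t)) vertices-unique , λ x y x≢y →
      +-cancelʳ-≤ (loss t x y) k _ (≤-trans (bound x y x≢y)
        (≤-reflexive (sym (ΔS-+-loss (complement t) (complement-missesExactly t) x y))))

    resolving⇒loss-bound : ∀ {k S} → IsWeakResolving G k S → ∀ {x y} → x ≢ y →
                           k + loss (outside S) x y ≤ total x y
    resolving⇒loss-bound {k} {S} (S-unique , resolves) {x} {y} x≢y =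
      ≤-trans (+-monoˡ-≤ (loss (outside S) x y) (resolves x y x≢y))
              (≤-reflexive (ΔS-+-loss S (outside-missesExactly S S-unique) x y))

    off-diagonal-resolving : ∀ P {k c} → k + 3 ≤ 2 * n + 2 → k + c + 6 ≤ 4 * n →
      (∀ {a a′ b b′} → a ≢ a′ → b ≢ b′ →
         ∑ (allFin n) (λ i → δ (i , i) (a , b) (a′ , b′) when P i) ≤ c) →
      IsWeakResolving G k (complement (diagonal P))
    off-diagonal-resolving P {k} {c} collinear-ok apart-ok apart-loss =
      complement-resolving (diagonal P) (λ x y x≢y → by-position (position x y) x≢y)
      where
      open ≤-Reasoning
      loss≡ : ∀ x y → loss (diagonal P) x y ≡ ∑ (allFin n) (λ i → δ (i , i) x y when P i)
      loss≡ x y = ∑V-diagonal (λ z → δ z x y) P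
      collinear : ∀ x y → diagonal-δ x y ≤ 3 → total x y ≡ 2 * n + 2 →
                  k + loss (diagonal P) x y ≤ total x y
      collinear x y diagonal≤3 total≡ = begin
        k + loss (diagonal P) x y  ≤⟨ +-monoʳ-≤ k (≤-trans (≤-reflexive (loss≡ x y))
                                        (≤-trans (∑-mono (allFin n) (λ i → when-≤ _ (P i))) diagonal≤3)) ⟩
        k + 3                      ≤⟨ collinear-ok ⟩
        2 * n + 2                  ≡⟨ total≡ ⟨
        total x y                  ∎
      by-position : ∀ {x y} → Position x y → x ≢ y → k + loss (diagonal P) x y ≤ total x y
      by-position equal x≢x = ⊥-elim (x≢x refl)
      by-position (same-row {a} {b} {b′} b≢b′) _ =
        collinear (a , b) (a , b′) (diagonal-δ-same-row a b≢b′) (total-same-row a b≢b′)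
      by-position (same-col {a} {a′} {b} a≢a′) _ =
        collinear (a , b) (a′ , b) (diagonal-δ-same-col b a≢a′) (total-same-col b a≢a′)
      by-position (apart {a} {a′} {b} {b′} a≢a′ b≢b′) _ = +-cancelʳ-≤ 6 _ _ (begin
        k + loss (diagonal P) (a , b) (a′ , b′) + 6
          ≤⟨ +-monoˡ-≤ 6 (+-monoʳ-≤ k (≤-trans (≤-reflexive (loss≡ (a , b) (a′ , b′)))
                                               (apart-loss a≢a′ b≢b′))) ⟩
        k + c + 6                    ≤⟨ apart-ok ⟩
        4 * n                        ≡⟨ total-apart a≢a′ b≢b′ ⟨
        total (a , b) (a′ , b′) + 6  ∎)

    module Missing {k S} (resolving : IsWeakResolving G k S) where

      missing-list-bound : ∀ x y M → x ≢ y → Unique M → All (λ z → outside S z ≡ true) M →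
                           k + ∑ M (λ z → δ z x y) ≤ total x y
      missing-list-bound x y M x≢y M-unique M-missing =
        ≤-trans (+-monoʳ-≤ k (∑-≤-when M M-unique M-missing _)) (resolving⇒loss-bound resolving x≢y)

      missing-endpoints-bound : ∀ {x y} → x ≢ y → outside S x ≡ true → outside S y ≡ true →
                                k + (d y x + d x y) ≤ total x y
      missing-endpoints-bound {x} {y} x≢y x-missing y-missing = subst (λ m → k + m ≤ total x y)
        (cong₂ _+_ (δ-left x y) (trans (+-identityʳ _) (δ-right x y)))
        (missing-list-bound x y (x ∷ y ∷ []) x≢y ((x≢y ∷ []) ∷ [] ∷ []) (x-missing ∷ y-missing ∷ []))

      missing-vertex-bound : ∀ {a b} → outside S (a , b) ≡ true → k + 2 ≤ 2 * n + 2
      missing-vertex-bound {a} {b} missing with avoid 3≤n b b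
      ... | b′ , b≢b′ , _ = subst₂ (λ m t → k + m ≤ t)
        (trans (+-identityʳ _) (trans (δ-left (a , b) (a , b′)) (d-same-row {a} (b≢b′ ∘ sym))))
        (total-same-row a b≢b′)
        (missing-list-bound (a , b) (a , b′) ((a , b) ∷ []) (b≢b′ ∘ ,-injectiveʳ)
                            ([] ∷ []) (missing ∷ []))

      missing-same-row-bound : ∀ {a b b′} → b ≢ b′ →
        outside S (a , b) ≡ true → outside S (a , b′) ≡ true → k + 4 ≤ 2 * n + 2
      missing-same-row-bound {a} b≢b′ b-missing b′-missing = subst₂ (λ m t → k + m ≤ t)
        (cong₂ _+_ (d-same-row {a} (b≢b′ ∘ sym)) (d-same-row {a} b≢b′)) (total-same-row a b≢b′)
        (missing-endpoints-bound (b≢b′ ∘ ,-injectiveʳ) b-missing b′-missing)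

      missing-same-col-bound : ∀ {a a′ b} → a ≢ a′ →
        outside S (a , b) ≡ true → outside S (a′ , b) ≡ true → k + 4 ≤ 2 * n + 2
      missing-same-col-bound {b = b} a≢a′ a-missing a′-missing = subst₂ (λ m t → k + m ≤ t)
        (cong₂ _+_ (d-same-col {b = b} (a≢a′ ∘ sym)) (d-same-col {b = b} a≢a′)) (total-same-col b a≢a′)
        (missing-endpoints-bound (a≢a′ ∘ ,-injectiveˡ) a-missing a′-missing)

      missing-pair-bound : ∀ {u w} → u ≢ w →
        outside S u ≡ true → outside S w ≡ true → k + 3 ≤ 2 * n + 2
      missing-pair-bound u≢w = by-position (position _ _) u≢w
        where
        by-position : ∀ {u w} → Position u w → u ≢ w → outside S u ≡ true → outside S w ≡ true →
                      k + 3 ≤ 2 * n + 2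
        by-position equal u≢u _ _ = ⊥-elim (u≢u refl)
        by-position (same-row b≢b′) _ u-missing w-missing =
          ≤-trans (+-monoʳ-≤ k (n≤1+n 3)) (missing-same-row-bound b≢b′ u-missing w-missing)
        by-position (same-col a≢a′) _ u-missing w-missing =
          ≤-trans (+-monoʳ-≤ k (n≤1+n 3)) (missing-same-col-bound a≢a′ u-missing w-missing)
        -- Use the pair u, (a , b′) in the row of u: u contributes 2 and w contributes |1 - 2|.
        by-position (apart {a} {a′} {b} {b′} a≢a′ b≢b′) u≢w u-missing w-missing =
          subst₂ (λ m t → k + m ≤ t)
          (cong₂ _+_ (trans (δ-left (a , b) (a , b′)) (d-same-row {a} (b≢b′ ∘ sym)))
                     (cong (_+ 0) (cong₂ ∣_-_∣ (d-apart a≢a′ b≢b′) (d-same-col {b = b′} a≢a′))))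
          (total-same-row a b≢b′)
          (missing-list-bound (a , b) (a , b′) ((a , b) ∷ (a′ , b′) ∷ []) (b≢b′ ∘ ,-injectiveʳ)
                              ((u≢w ∷ []) ∷ [] ∷ []) (u-missing ∷ w-missing ∷ []))

      all-present : 2 * n < k → count (outside S) ≡ 0
      all-present 2n<k = ∑-when-false (λ _ → 1) vertices (All.tabulate (λ {u} _ → present u))
        where
        present : ∀ u → outside S u ≡ false
        present u with outside S u in u-missing
        ... | false = refl
        ... | true  = ⊥-elim (<⇒≱ (+-monoˡ-< 2 2n<k) (missing-vertex-bound u-missing))

      at-most-one-missing : 2 * n ≤ k → count (outside S) ≤ 1
      at-most-one-missing 2n≤k = ∑-at-most-one vertices vertices-unique missing-unique
        where
        missing-unique : ∀ {u w} → outside S u ≡ true → outside S w ≡ true → u ≡ w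
        missing-unique {u} {w} u-missing w-missing with u ≟V w
        ... | yes u≡w = u≡w
        ... | no  u≢w = ⊥-elim (<⇒≱ (subst (_≤ k + 3) (+-suc (2 * n) 2) (+-monoˡ-≤ 3 2n≤k))
                                     (missing-pair-bound u≢w u-missing w-missing))

      module _ (2n≤k+1 : 2 * n ≤ k + 1) where

        2n+2<k+4 : 2 * n + 2 < k + 4
        2n+2<k+4 = subst₂ _≤_ (+-suc (2 * n) 2) (+-assoc k 1 3) (+-monoˡ-≤ 3 2n≤k+1)

        row-missing-unique : ∀ {a b b′} →
          outside S (a , b) ≡ true → outside S (a , b′) ≡ true → b ≡ b′
        row-missing-unique {b = b} {b′} b-missing b′-missing with b ≟ b′
        ... | yes b≡b′ = b≡b′
        ... | no  b≢b′ = ⊥-elim (<⇒≱ 2n+2<k+4 (missing-same-row-bound b≢b′ b-missing b′-missing))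

        col-missing-unique : ∀ {a a′ b} →
          outside S (a , b) ≡ true → outside S (a′ , b) ≡ true → a ≡ a′
        col-missing-unique {a} {a′} a-missing a′-missing with a ≟ a′
        ... | yes a≡a′ = a≡a′
        ... | no  a≢a′ = ⊥-elim (<⇒≱ 2n+2<k+4 (missing-same-col-bound a≢a′ a-missing a′-missing))

        missing-in-row≤1 : ∀ a → ∑ (allFin n) (λ j → 1 when outside S (a , j)) ≤ 1
        missing-in-row≤1 a = ∑-at-most-one (allFin n) (allFin⁺ n) row-missing-unique

        at-most-n-missing : count (outside S) ≤ n
        at-most-n-missing = begin
          count (outside S)
            ≡⟨ ∑V-rows _ ⟩
          ∑ (allFin n) (λ i → ∑ (allFin n) (λ j → 1 when outside S (i , j)))
            ≤⟨ ∑≤length (allFin n) missing-in-row≤1 ⟩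
          length (allFin n)
            ≡⟨ length-allFin ⟩
          n ∎
          where open ≤-Reasoning

  IsWdim-KnxKn : ∀ {k c} t → IsWeakResolving G k (complement t) → count t ≡ c →
                 (∀ S → IsWeakResolving G k S → count (outside S) ≤ c) → IsWdim G k (n * n ∸ c)
  IsWdim-KnxKn {k} {c} t resolving count≡c bound = subst (λ m → IsWdim G k (m ∸ c)) length-vertices
    (IsWdim-intro G vertices-unique vertices-complete t resolving count≡c bound)

  module _ (4≤n : 4 ≤ n) where

    private
      3≤n : 3 ≤ n
      3≤n = ≤-trans (n≤1+n 3) 4≤n

    all-resolving : IsWeakResolving G (2 * n + 2) (complement (λ _ → false))
    all-resolving = complement-resolving 3≤n (λ _ → false) λ x y x≢y → begin
      2 * n + 2 + loss (λ _ → false) x y  ≡⟨ cong (2 * n + 2 +_) (∑-zero vertices) ⟩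
      2 * n + 2 + 0                       ≡⟨ +-identityʳ _ ⟩
      2 * n + 2                           ≤⟨ total-≥ 4≤n x≢y ⟩
      total x y                           ∎
      where open ≤-Reasoning

    all-but-one-resolving : ∀ u → IsWeakResolving G (2 * n) (complement (λ z → does (u ≟V z)))
    all-but-one-resolving u = complement-resolving 3≤n _ λ x y x≢y → begin
      2 * n + loss (λ z → does (u ≟V z)) x y  ≡⟨ cong (2 * n +_) (∑V-point (λ z → δ z x y) u) ⟩
      2 * n + δ u x y                         ≤⟨ +-monoʳ-≤ (2 * n) (δ≤2 u x y) ⟩
      2 * n + 2                               ≤⟨ total-≥ 4≤n x≢y ⟩
      total x y                               ∎
      where open ≤-Reasoning

    wdim-2n+2 : IsWdim G (2 * n + 2) (n * n)
    wdim-2n+2 = IsWdim-KnxKn (λ _ → false) all-resolving (∑-zero vertices)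
      λ S resolving → ≤-reflexive (Missing.all-present 3≤n resolving (m<m+n (2 * n) z<s))

    wdim-2n+1 : IsWdim G (2 * n + 1) (n * n)
    wdim-2n+1 = IsWdim-KnxKn (λ _ → false)
      (IsWeakResolving-mono G (+-monoʳ-≤ (2 * n) (n≤1+n 1)) all-resolving) (∑-zero vertices)
      λ S resolving → ≤-reflexive (Missing.all-present 3≤n resolving (m<m+n (2 * n) z<s))

    wdim-2n : IsWdim G (2 * n) (n * n ∸ 1)
    wdim-2n = IsWdim-KnxKn (λ z → does (u ≟V z)) (all-but-one-resolving u) (∑V-point (λ _ → 1) u)
      λ S resolving → Missing.at-most-one-missing 3≤n resolving ≤-refl
      where
      u : V
      u = let i = fromℕ< (≤-trans (s≤s z≤n) 4≤n) in i , i

    wdim-2n-1 : 5 ≤ n → IsWdim G (2 * n ∸ 1) (n * n ∸ n)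
    wdim-2n-1 5≤n = IsWdim-KnxKn (diagonal (λ _ → true))
      (off-diagonal-resolving 3≤n (λ _ → true) collinear-ok apart-ok diagonal-δ-apart) count-diagonal
      λ S resolving → Missing.at-most-n-missing 3≤n resolving 2n≤2n∸1+1
      where
      open ≤-Reasoning
      2n≤2n∸1+1 : 2 * n ≤ 2 * n ∸ 1 + 1
      2n≤2n∸1+1 = subst (2 * n ≤_) (+-comm 1 _) (m≤n+m∸n (2 * n) 1)
      1≤2n : 1 ≤ 2 * n
      1≤2n = ≤-trans (≤-trans (s≤s z≤n) 4≤n) (m≤m+n n (n + 0))
      collinear-ok : 2 * n ∸ 1 + 3 ≤ 2 * n + 2
      collinear-ok = ≤-reflexive (∸1+suc 1≤2n 2)
      apart-ok : 2 * n ∸ 1 + 4 + 6 ≤ 4 * n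
      apart-ok = begin
        2 * n ∸ 1 + 4 + 6  ≡⟨ +-assoc (2 * n ∸ 1) 4 6 ⟩
        2 * n ∸ 1 + 10     ≡⟨ ∸1+suc 1≤2n 9 ⟩
        2 * n + 9          ≤⟨ +-monoʳ-≤ (2 * n) (≤-trans (n≤1+n 9) (*-monoʳ-≤ 2 5≤n)) ⟩
        2 * n + 2 * n      ≡⟨ *-distribʳ-+ n 2 2 ⟨
        4 * n              ∎
      count-diagonal : count (diagonal (λ _ → true)) ≡ n
      count-diagonal = trans (∑V-diagonal (λ _ → 1) (λ _ → true)) (trans (∑-one (allFin n)) length-allFin)

module K₄×K₄ where
  open Geometry 4

  3≤4 : 3 ≤ 4
  3≤4 = s≤s (s≤s (s≤s z≤n))

  module _ {S} (resolving : IsWeakResolving G 7 S) where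
    open Missing 3≤4 resolving

    -- x and y are apart, and every vertex of the transversal shares a line with exactly one of them,
    -- so it is at distance 2 from one and 1 from the other and contributes 1 to the loss.
    no-missing-transversal : (σ : Fin 4 → Fin 4) → (∀ i → outside S (i , σ i) ≡ true) → ⊥
    no-missing-transversal σ missing = <⇒≱ (≤-refl {17}) (begin
      7 + 4 + 6      ≤⟨ +-monoˡ-≤ 6 (subst (λ m → 7 + m ≤ total x y) transversal-δ
                          (missing-list-bound x y transversal (λ ()) transversal-unique
                            (missing (# 0) ∷ missing (# 1) ∷ missing (# 2) ∷ missing (# 3) ∷ []))) ⟩
      total x y + 6  ≡⟨ total-apart {# 0} {# 1} {σ (# 2)} {σ (# 3)} (λ ()) (σ-distinct (λ ())) ⟩
      16             ∎)
      where
      open ≤-Reasoning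
      σ-injective : ∀ {i j} → σ i ≡ σ j → i ≡ j
      σ-injective {i} {j} σi≡σj =
        col-missing-unique ≤-refl (missing i)
          (subst (λ b → outside S (j , b) ≡ true) (sym σi≡σj) (missing j))
      σ-distinct : ∀ {i j} → i ≢ j → σ i ≢ σ j
      σ-distinct i≢j = i≢j ∘ σ-injective
      x y : V
      x = (# 0 , σ (# 2))
      y = (# 1 , σ (# 3))
      transversal : List V
      transversal = (# 0 , σ (# 0)) ∷ (# 1 , σ (# 1)) ∷ (# 2 , σ (# 2)) ∷ (# 3 , σ (# 3)) ∷ []
      transversal-unique : Unique transversal
      transversal-unique =
        ((λ ()) ∷ (λ ()) ∷ (λ ()) ∷ []) ∷ ((λ ()) ∷ (λ ()) ∷ []) ∷ ((λ ()) ∷ []) ∷ [] ∷ []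
      transversal-δ : ∑ transversal (λ z → δ z x y) ≡ 4
      transversal-δ =
        cong₂ _+_ (cong₂ ∣_-_∣ (d-same-row {# 0} {σ (# 2)} {σ (# 0)} (σ-distinct λ ()))
                               (d-apart {# 1} {# 0} {σ (# 3)} {σ (# 0)} (λ ()) (σ-distinct λ ())))
       (cong₂ _+_ (cong₂ ∣_-_∣ (d-apart {# 0} {# 1} {σ (# 2)} {σ (# 1)} (λ ()) (σ-distinct λ ()))
                               (d-same-row {# 1} {σ (# 3)} {σ (# 1)} (σ-distinct λ ())))
       (cong₂ _+_ (cong₂ ∣_-_∣ (d-same-col {# 0} {# 2} {σ (# 2)} (λ ()))
                               (d-apart {# 1} {# 2} {σ (# 3)} {σ (# 2)} (λ ()) (σ-distinct λ ())))
       (cong₂ _+_ (cong₂ ∣_-_∣ (d-apart {# 0} {# 3} {σ (# 2)} {σ (# 3)} (λ ()) (σ-distinct λ ()))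
                               (d-same-col {# 1} {# 3} {σ (# 3)} (λ ()))) refl)))

    every-row-missing : 4 ≤ count (outside S) → ∀ i → ∃[ j ] outside S (i , j) ≡ true
    every-row-missing 4≤count i = ∑-when-witness (allFin 4) (All.lookup rows-full (∈-allFin i))
      where
      rows-full : All (λ i → 1 ≤ ∑ (allFin 4) (λ j → 1 when outside S (i , j))) (allFin 4)
      rows-full = length≤∑⇒All-positive (allFin 4) (missing-in-row≤1 ≤-refl)
                    (subst (4 ≤_) (∑V-rows (λ z → 1 when outside S z)) 4≤count)

    at-most-three-missing : count (outside S) ≤ 3
    at-most-three-missing = ≮⇒≥ λ 4≤count →
      let every = every-row-missing 4≤count in no-missing-transversal (proj₁ ∘ every) (proj₂ ∘ every)

  wdim-7 : IsWdim G 7 13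
  wdim-7 = IsWdim-KnxKn {c = 3} (diagonal three-of-four)
    (off-diagonal-resolving 3≤4 three-of-four ≤-refl ≤-refl apart-loss) refl (λ S → at-most-three-missing)
    where
    three-of-four : Fin 4 → Bool
    three-of-four i = not (does (i ≟ # 3))
    apart-loss : ∀ {a a′ b b′} → a ≢ a′ → b ≢ b′ →
                 ∑ (allFin 4) (λ i → δ (i , i) (a , b) (a′ , b′) when three-of-four i) ≤ 3
    apart-loss a≢a′ b≢b′ =
      ∑-mono (allFin 4) (λ i → when-mono (three-of-four i) (δ-apart≤1 a≢a′ b≢b′ (i , i)))

mainTheorem6 : ((n : ℕ) → 4 ≤ n →
    IsWdim (KnxKn n) (2 * n + 1) (n * n) ×
    IsWdim (KnxKn n) (2 * n + 2) (n * n) ×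
    IsWdim (KnxKn n) (2 * n) (n * n ∸ 1) ×
    (5 ≤ n → IsWdim (KnxKn n) (2 * n ∸ 1) (n * n ∸ n))) ×
    IsWdim (KnxKn 4) 7 13
mainTheorem6 = general , K₄×K₄.wdim-7
  where
  general : (n : ℕ) → 4 ≤ n →
    IsWdim (KnxKn n) (2 * n + 1) (n * n) ×
    IsWdim (KnxKn n) (2 * n + 2) (n * n) ×
    IsWdim (KnxKn n) (2 * n) (n * n ∸ 1) ×
    (5 ≤ n → IsWdim (KnxKn n) (2 * n ∸ 1) (n * n ∸ n))
  general n 4≤n = wdim-2n+1 4≤n , wdim-2n+2 4≤n , wdim-2n 4≤n , wdim-2n-1 4≤n
    where open Geometry n
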